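{- Let $k\ge 3$, let $G=(V,E)$ be a graph with a partition $\{S_1,\dots,S_k\}$ of $V$, and let $H$ be a proper subgraph of $G$ with a partition $\{S'_1,\dots,S'_k\}$ of $V(H)$ such that $S'_i\subset S_i$ for $i=1,\dots,k$. Suppose that $$d^G_{v_l}(S_i)-d^G_{v_l}(S_i,S_j)=\lambda\quad\text{for all } i\neq j \text{ in } [k] \text{ and all } v_l\in S_i,$$ and $$d^H_{v_l}(S'_i)-d^H_{v_l}(S'_i,S'_j)=0\quad\text{for all } i\neq j \text{ in } [k] \text{ and all } v_l\in S'_i.$$ Then the graph $G'=G-E(H)$ (same vertex set $V$, edge set $E\setminus E(H)$) satisfies $$d^{G'}_{v_l}(S_i)-d^{G'}_{v_l}(S_i,S_j)=\lambda\quad\text{for all } i\neq j \text{ in } [k] \text{ and all } v_l\in S_i.$$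
   Context: Graphs are finite, simple and undirected. For a graph $X$, a vertex subset $T$ and $v\in T$, $d^X_v(T)$ is the number of neighbours of $v$ in $T$ in the graph $X$; for disjoint vertex subsets $T,U$ and $v\in T$, $d^X_v(T,U)$ is the number of neighbours of $v$ in $U$ in the graph $X$. (By the paper's characterization, for $X$ with partition $\{T_1,\dots,T_k\}$ these conditions with constant $\lambda$ are equivalent to all vectors $\mathbf{s}^{(i)}$, equal to $-k+1$ on $T_i$ and $1$ elsewhere, being eigenvectors of the adjacency matrix of $X$ for $\lambda$.) -}

module Defs where

open import Data.Nat using (ℕ; zero; suc; _+_; _≥_)
open import Data.Bool using (Bool; true; false; _∧_; not; if_then_else_)
open import Data.Fin using (Fin; zero; suc; _≟_)
open import Data.Integer using (ℤ; +_; _-_)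
open import Data.Product using (_×_; ∃)
open import Relation.Nullary using (¬_)
open import Relation.Nullary.Decidable using (⌊_⌋)
open import Relation.Binary.PropositionalEquality using (_≡_; refl)

record SimpleGraph (n : ℕ) : Set where
  field
    adj    : Fin n → Fin n → Bool
    sym    : ∀ u v → adj u v ≡ adj v u
    irrefl : ∀ v → adj v v ≡ false
open SimpleGraph public

Subset : ℕ → Set
Subset n = Fin n → Bool

count : ∀ {n} → (Fin n → Bool) → ℕ
count {zero}  p = 0
count {suc n} p = (if p zero then 1 else 0) + count (λ i → p (suc i))

-- number of neighbours of v lying in T, in the graph with adjacency `a`
-- (this is d_v(T), and also d_v(T,U) when applied to U)
deg : ∀ {n} → (Fin n → Fin n → Bool) → Subset n → Fin n → ℕ
deg a T v = count (λ u → a v u ∧ T u)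

block : ∀ {n k} → (Fin n → Fin k) → Fin k → Subset n
block part i v = ⌊ part v ≟ i ⌋

IsPartition : ∀ {n k} → (Fin n → Fin k) → Set
IsPartition {n} {k} part = ∀ (i : Fin k) → ∃ λ (v : Fin n) → part v ≡ i

Condition : ∀ {n k} → (Fin n → Fin n → Bool) → Subset n → (Fin n → Fin k) → ℤ → Set
Condition {n} {k} a W part λ' =
  ∀ (i j : Fin k) → ¬ (i ≡ j) → ∀ (v : Fin n) → W v ≡ true → part v ≡ i →
    (+ deg a (λ u → W u ∧ block part i u) v) - (+ deg a (λ u → W u ∧ block part j u) v) ≡ λ'

full : ∀ {n} → Subset n
full _ = true

removeEdges : ∀ {n} → SimpleGraph n → SimpleGraph n → SimpleGraph n
removeEdges G H = record
  { adj = λ u v → adj G u v ∧ not (adj H u v) ; sym = symP ; irrefl = irr }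
  where
  symP : ∀ u v → (adj G u v ∧ not (adj H u v)) ≡ (adj G v u ∧ not (adj H v u))
  symP u v rewrite SimpleGraph.sym G u v | SimpleGraph.sym H u v = refl
  irr : ∀ v → (adj G v v ∧ not (adj H v v)) ≡ false
  irr v rewrite SimpleGraph.irrefl G v = refl

{-# OPTIONS --safe #-}
module Submission where

-- Since H ⊆ G, every degree in G splits as a degree in H plus a degree in G − E(H); and an
-- H-neighbour of v lies in V(H), where the two partitions agree. For v ∈ S_i the H-part of
-- d_v(S_i) − d_v(S_i,S_j) is 0 by the hypothesis on H (and trivially 0 when v ∉ V(H), as v is
-- then isolated in H), so the G-difference λ is also the (G − E(H))-difference.

open import Defs hiding (sym)
open import Data.Nat using (ℕ; _≥_; zero; suc; _+_)
open import Data.Nat.Properties using (+-identityʳ; +-commutativeSemigroup)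
open import Algebra.Properties.CommutativeSemigroup +-commutativeSemigroup using (interchange)
open import Data.Bool using (Bool; true; false; _∧_; not; if_then_else_)
open import Data.Fin as Fin using (Fin; _≟_)
open import Data.Integer using (ℤ; +_; _-_; _⊖_)
open import Data.Integer.Properties using (m-n≡m⊖n; +-cancelˡ-⊖; +-injective; i-j≡0⇒i≡j)
open import Data.Product using (_×_; ∃)
open import Relation.Nullary using (¬_)
open import Relation.Nullary.Decidable using (⌊_⌋)
open import Relation.Binary.PropositionalEquality using (_≡_; refl; sym; trans; cong; cong₂; module ≡-Reasoning)

open ≡-Reasoning

ind : Bool → ℕ
ind b = if b then 1 else 0

count-additive : ∀ {n} (f g h : Fin n → Bool) →
  (∀ u → ind (f u) ≡ ind (g u) + ind (h u)) → count f ≡ count g + count h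
count-additive {zero}  f g h f≡g+h = refl
count-additive {suc n} f g h f≡g+h = begin
  ind (f Fin.zero) + count (λ u → f (Fin.suc u))
    ≡⟨ cong₂ _+_ (f≡g+h Fin.zero)
         (count-additive (λ u → f (Fin.suc u)) (λ u → g (Fin.suc u)) (λ u → h (Fin.suc u)) (λ u → f≡g+h (Fin.suc u))) ⟩
  (ind (g Fin.zero) + ind (h Fin.zero)) + (count (λ u → g (Fin.suc u)) + count (λ u → h (Fin.suc u)))
    ≡⟨ interchange (ind (g Fin.zero)) (ind (h Fin.zero)) _ _ ⟩
  count g + count h ∎

count-false : ∀ {n} (f : Fin n → Bool) → (∀ u → f u ≡ false) → count f ≡ 0
count-false {zero}  f f≡false = refl
count-false {suc n} f f≡false rewrite f≡false Fin.zero = count-false (λ u → f (Fin.suc u)) (λ u → f≡false (Fin.suc u))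

deg-isolated : ∀ {n} (a : Fin n → Fin n → Bool) (T : Subset n) v → (∀ u → a v u ≡ false) → deg a T v ≡ 0
deg-isolated a T v isolated = count-false (λ u → a v u ∧ T u) (λ u → cong (_∧ T u) (isolated u))

ind-∧-split : ∀ g h t t′ → (h ≡ true → g ≡ true) → (h ≡ true → t′ ≡ t) →
  ind (g ∧ t) ≡ ind (h ∧ t′) + ind ((g ∧ not h) ∧ t)
ind-∧-split true  false t t′ _ _ = refl
ind-∧-split false false t t′ _ _ = refl
ind-∧-split g     true  t t′ h⇒g h⇒t′≡t with h⇒g refl | h⇒t′≡t refl
... | refl | refl = sym (+-identityʳ (ind t))

deg-removeEdges : ∀ {n} (G H : SimpleGraph n) → (∀ u v → adj H u v ≡ true → adj G u v ≡ true) →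
  ∀ (T T′ : Subset n) v → (∀ u → adj H v u ≡ true → T′ u ≡ T u) →
  deg (adj G) T v ≡ deg (adj H) T′ v + deg (adj (removeEdges G H)) T v
deg-removeEdges G H H⊆G T T′ v agree = count-additive _ _ _ λ u →
  ind-∧-split (adj G v u) (adj H v u) (T u) (T′ u) (H⊆G v u) (agree u)

+[c+a]-+[c+b]≡+a-+b : ∀ a b c → + (c + a) - + (c + b) ≡ + a - + b
+[c+a]-+[c+b]≡+a-+b a b c = begin
  + (c + a) - + (c + b) ≡⟨ m-n≡m⊖n (c + a) (c + b) ⟩
  (c + a) ⊖ (c + b)     ≡⟨ +-cancelˡ-⊖ c a b ⟩
  a ⊖ b                 ≡⟨ sym (m-n≡m⊖n a b) ⟩
  + a - + b             ∎

corollary5p1 :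
    ∀ (n k : ℕ) → k ≥ 3 →
    ∀ (G : SimpleGraph n) (part : Fin n → Fin k) → IsPartition part →
    ∀ (H : SimpleGraph n) (VH : Subset n) →
    (∀ u v → adj H u v ≡ true → VH u ≡ true) →
    (∀ u v → adj H u v ≡ true → adj G u v ≡ true) →
    ¬ ((∀ v → VH v ≡ true) × (∀ u v → adj H u v ≡ adj G u v)) →
    ∀ (part′ : Fin n → Fin k) →
    (∀ (i : Fin k) → ∃ λ (v : Fin n) → (VH v ≡ true) × (part′ v ≡ i)) →
    (∀ v → VH v ≡ true → part′ v ≡ part v) →
    ∀ (λ′ : ℤ) →
    Condition (adj G) full part λ′ →
    Condition (adj H) VH part′ (+ 0) →
    Condition (adj (removeEdges G H)) full part λ′
corollary5p1 n k _ G part _ H VH H⊆VH H⊆G _ part′ _ part′≡part λ′ condG condH i j i≢j v _ pv = begin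
  + d′ i - + d′ j                 ≡˘⟨ +[c+a]-+[c+b]≡+a-+b (d′ i) (d′ j) (h i) ⟩
  + (h i + d′ i) - + (h i + d′ j) ≡⟨ cong (λ c → + (h i + d′ i) - + (c + d′ j)) H-balanced ⟩
  + (h i + d′ i) - + (h j + d′ j) ≡˘⟨ cong₂ (λ x y → + x - + y) (split i) (split j) ⟩
  + d i - + d j                   ≡⟨ condG i j i≢j v refl pv ⟩
  λ′                              ∎
  where
  d d′ h : Fin k → ℕ
  d  l = deg (adj G) (block part l) v
  d′ l = deg (adj (removeEdges G H)) (block part l) v
  h  l = deg (adj H) (λ u → VH u ∧ block part′ l u) v

  neighbour-in-VH : ∀ {u} → adj H v u ≡ true → VH u ≡ true
  neighbour-in-VH {u} vu = H⊆VH u v (trans (SimpleGraph.sym H u v) vu)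

  split : ∀ l → d l ≡ h l + d′ l
  split l = deg-removeEdges G H H⊆G _ _ v λ u vu →
    let u∈VH = neighbour-in-VH vu in
    trans (cong (_∧ block part′ l u) u∈VH) (cong (λ p → ⌊ p ≟ l ⌋) (part′≡part u u∈VH))

  H-balanced : h i ≡ h j
  H-balanced with VH v in v∈VH
  ... | true  = +-injective (i-j≡0⇒i≡j _ _ (condH i j i≢j v v∈VH (trans (part′≡part v v∈VH) pv)))
  ... | false = trans (deg-isolated (adj H) _ v isolated) (sym (deg-isolated (adj H) _ v isolated))
    where
    isolated : ∀ u → adj H v u ≡ false
    isolated u with adj H v u in vu
    ... | false = refl
    ... | true with trans (sym v∈VH) (H⊆VH v u vu)
    ...   | ()
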